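{- Let $G$ be a finite graph such that $\iota(G)\neq 0$ or $\iota(\overline{G})\neq 0$. Then $$p(G)\geq\lceil\log_2(\max(\iota(G),\iota(\overline{G}))+1)\rceil.$$
   Context: Graphs are finite, simple and undirected; $\overline{G}$ is the complement of $G$ and $\iota(G)$ is the number of isolated vertices of $G$. For $W\subseteq V(H)$, $H[W]$ is the induced subgraph. A subset $M\subseteq V(G)$ is a module of $G$ if every $v\in V(G)\setminus M$ is adjacent either to all vertices of $M$ or to none of them; the modules $\emptyset$, $V(G)$ and singletons are trivial. A graph is prime if it has at least 4 vertices and all its modules are trivial. An extension of $G$ is a graph $H$ with $V(H)\supseteq V(G)$ and $H[V(G)]=G$; a $p$-extension is one with $|V(H)\setminus V(G)|=p$. The prime bound $p(G)$ is the smallest integer $p\ge 0$ such that $G$ admits a prime $p$-extension. -}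

module Defs where

open import Data.Nat using (ℕ; zero; suc; _+_; _≤_)
open import Data.Fin using (Fin; _↑ˡ_; _≟_)
open import Data.Bool using (Bool; true; false; not; _∧_; if_then_else_)
open import Data.List using (List; allFin; map)
open import Data.Bool.ListAction using (and)
open import Data.Nat.ListAction using (sum)
open import Data.Product using (Σ; ∃; _×_; _,_)
open import Data.Sum using (_⊎_)
open import Relation.Nullary using (¬_; yes; no)
open import Relation.Nullary.Decidable using (⌊_⌋)
open import Relation.Binary.PropositionalEquality using (_≡_; refl; sym; cong)

record Graph (n : ℕ) : Set where
  field
    adj    : Fin n → Fin n → Bool
    adj-sym    : ∀ x y → adj x y ≡ adj y x
    adj-irrefl : ∀ x → adj x x ≡ false
open Graph public

complement : ∀ {n} → Graph n → Graph n
complement {n} G = record { adj = a ; adj-sym = s ; adj-irrefl = i }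
  where
  a : Fin n → Fin n → Bool
  a x y = not (adj G x y) ∧ not ⌊ x ≟ y ⌋
  s : ∀ x y → a x y ≡ a y x
  s x y with x ≟ y | y ≟ x
  ... | yes p | yes q = cong (λ b → not b ∧ false) (adj-sym G x y)
  ... | yes refl | no q = ⊥-case
    where ⊥-case : not (adj G x x) ∧ false ≡ not (adj G x x) ∧ true
          ⊥-case with q refl
          ... | ()
  ... | no p | yes refl = ⊥-case
    where ⊥-case : not (adj G x x) ∧ true ≡ not (adj G x x) ∧ false
          ⊥-case with p refl
          ... | ()
  ... | no p | no q = cong (λ b → not b ∧ true) (adj-sym G x y)
  i : ∀ x → a x x ≡ false
  i x with x ≟ x
  ... | yes _ = lemma (adj G x x)
    where lemma : ∀ b → not b ∧ false ≡ false
          lemma true = refl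
          lemma false = refl
  ... | no q with q refl
  ... | ()

isIsolated : ∀ {n} → Graph n → Fin n → Bool
isIsolated {n} G v = and (map (λ w → not (adj G v w)) (allFin n))

ι : ∀ {n} → Graph n → ℕ
ι {n} G = sum (map (λ v → if isIsolated G v then 1 else 0) (allFin n))

VSet : ℕ → Set
VSet n = Fin n → Bool

IsModule : ∀ {n} → Graph n → VSet n → Set
IsModule {n} G M =
  ∀ (v : Fin n) → M v ≡ false →
    (∀ x → M x ≡ true → adj G v x ≡ true) ⊎ (∀ x → M x ≡ true → adj G v x ≡ false)

IsTrivialSet : ∀ {n} → VSet n → Set
IsTrivialSet {n} M =
  (∀ x → M x ≡ false) ⊎ (∀ x → M x ≡ true) ⊎
  (Σ (Fin n) λ v → ∀ x → (M x ≡ true → x ≡ v) × (x ≡ v → M x ≡ true))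

IsPrime : ∀ {n} → Graph n → Set
IsPrime {n} G = (4 ≤ n) × (∀ M → IsModule G M → IsTrivialSet M)

IsExtension : ∀ {n} p → Graph n → Graph (n + p) → Set
IsExtension {n} p G H = ∀ x y → adj H (x ↑ˡ p) (y ↑ˡ p) ≡ adj G x y

module Submission where

-- Call a vertex v of G c-uniform if adj G v w ≡ c for
-- every w ≠ v: the isolated vertices of G are the false-uniform ones, those
-- of the complement are the true-uniform ones.  Let H be a prime
-- p-extension of G and record for each old vertex v its trace
-- x ↦ adj H v x on the p new vertices.  For c-uniform vertices of G:
--   * if the trace of v is constantly c, then v is c-uniform in H, so
--     V(H) ∖ {v} is a non-trivial module;
--   * if u ≠ v have the same trace, they are twins in H, so {u, v} is a
--     non-trivial module.
-- Hence "constant c" together with the traces of the k uniform vertices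
-- gives k + 1 distinct maps Fin p → Bool, i.e. k + 1 ≤ 2 ^ p.  Applied with
-- c = false and c = true this bounds max(ι G, ι Ḡ) + 1 by 2 ^ p, and taking
-- ⌈log₂⌉ gives the theorem.

open import Defs
open import Data.Nat using (ℕ; _+_; _≤_; _⊔_; suc)
open import Data.Nat.Logarithm using (⌈log₂_⌉)
open import Data.Sum using (_⊎_)
open import Relation.Binary.PropositionalEquality using (_≢_)

open import Data.Nat using (zero; _^_; s≤s)
open import Data.Nat.Properties using (⊔-lub; ≤-trans; n≤1+n)
open import Data.Nat.Logarithm using (⌈log₂⌉-mono-≤; ⌈log₂2^n⌉≡n)
open import Data.Fin as F using (Fin; _↑ˡ_; _↑ʳ_; splitAt; punchIn; punchOut; _≟_; funToFin; finToFun)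
open import Data.Fin.Properties
  using (2↔Bool; finToFun-funToFin; injective⇒≤; splitAt⁻¹-↑ˡ; splitAt⁻¹-↑ʳ; ↑ˡ-injective;
         suc-injective; punchIn-injective; punchInᵢ≢i; punchIn-punchOut)
open import Data.Bool using (Bool; true; false; not; _∨_; if_then_else_)
open import Data.List using (_∷_; map; allFin; tabulate)
open import Data.List.Properties using (map-tabulate)
open import Data.List.Membership.Propositional using (_∈_)
open import Data.List.Membership.Propositional.Properties using (∈-map⁺; ∈-allFin)
open import Data.List.Relation.Unary.Any using (here; there)
open import Data.Bool.ListAction using (and)
open import Data.Nat.ListAction using (sum)
open import Data.Product using (∃; _×_; _,_; proj₁; proj₂)
open import Data.Sum using (inj₁; inj₂)
open import Data.Empty using (⊥-elim)
open import Function using (_∘_)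
open import Function.Bundles using (Inverse)
open import Function.Definitions using (Injective)
open import Relation.Nullary using (¬_; yes; no)
open import Relation.Nullary.Decidable using (⌊_⌋)
open import Relation.Binary.PropositionalEquality
  using (_≡_; refl; sym; trans; cong; subst; module ≡-Reasoning)

count : ∀ {n} → (Fin n → Bool) → ℕ
count {zero}  P = 0
count {suc n} P = (if P F.zero then 1 else 0) + count (P ∘ F.suc)

sum-indicator≡count : ∀ {n} (P : Fin n → Bool) →
  sum (map (λ v → if P v then 1 else 0) (allFin n)) ≡ count P
sum-indicator≡count {n} P =
  trans (cong sum (map-tabulate (λ v → v) (λ v → if P v then 1 else 0))) (go P)
  where
  go : ∀ {m} (Q : Fin m → Bool) → sum (tabulate (λ v → if Q v then 1 else 0)) ≡ count Q
  go {zero}  Q = refl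
  go {suc m} Q = cong ((if Q F.zero then 1 else 0) +_) (go (Q ∘ F.suc))

enumerate : ∀ {n} (P : Fin n → Bool) → Fin (count P) → Fin n
enumerate {suc n} P i with P F.zero
enumerate {suc n} P F.zero    | true  = F.zero
enumerate {suc n} P (F.suc i) | true  = F.suc (enumerate (P ∘ F.suc) i)
enumerate {suc n} P i         | false = F.suc (enumerate (P ∘ F.suc) i)

enumerate-sound : ∀ {n} (P : Fin n → Bool) (i : Fin (count P)) → P (enumerate P i) ≡ true
enumerate-sound {suc n} P i with P F.zero in P0
enumerate-sound {suc n} P F.zero    | true  = P0
enumerate-sound {suc n} P (F.suc i) | true  = enumerate-sound (P ∘ F.suc) i
enumerate-sound {suc n} P i         | false = enumerate-sound (P ∘ F.suc) i

enumerate-injective : ∀ {n} (P : Fin n → Bool) → Injective _≡_ _≡_ (enumerate P)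
enumerate-injective {suc n} P {i} {j} eq with P F.zero
enumerate-injective {suc n} P {F.zero}  {F.zero}  eq | true = refl
enumerate-injective {suc n} P {F.suc i} {F.suc j} eq | true =
  cong F.suc (enumerate-injective (P ∘ F.suc) (suc-injective eq))
enumerate-injective {suc n} P {i} {j} eq | false =
  enumerate-injective (P ∘ F.suc) (suc-injective eq)

encode : ∀ {p} → (Fin p → Bool) → Fin (2 ^ p)
encode f = funToFin (Inverse.from 2↔Bool ∘ f)

encode-injective : ∀ {p} (f g : Fin p → Bool) → encode f ≡ encode g → ∀ x → f x ≡ g x
encode-injective f g eq x = begin
  f x                          ≡⟨ Inverse.strictlyInverseˡ 2↔Bool (f x) ⟨
  to (from (f x))              ≡⟨ cong to (finToFun-funToFin (from ∘ f) x) ⟨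
  to (finToFun (encode f) x)   ≡⟨ cong (λ k → to (finToFun k x)) eq ⟩
  to (finToFun (encode g) x)   ≡⟨ cong to (finToFun-funToFin (from ∘ g) x) ⟩
  to (from (g x))              ≡⟨ Inverse.strictlyInverseˡ 2↔Bool (g x) ⟩
  g x                          ∎
  where
  open ≡-Reasoning
  to : Fin 2 → Bool
  to = Inverse.to 2↔Bool
  from : Bool → Fin 2
  from = Inverse.from 2↔Bool

Uniform : ∀ {N} → Graph N → Bool → Fin N → Set
Uniform K c v = ∀ w → w ≢ v → adj K v w ≡ c

Twins : ∀ {N} → Graph N → Fin N → Fin N → Set
Twins K u v = ∀ y → y ≢ u → y ≢ v → adj K u y ≡ adj K v y

and-member : ∀ {bs b} → and bs ≡ true → b ∈ bs → b ≡ true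
and-member {true ∷ bs} _   (here refl) = refl
and-member {true ∷ bs} all (there b∈)  = and-member all b∈
and-member {false ∷ bs} ()

isolated-nonadjacent : ∀ {N} (K : Graph N) v → isIsolated K v ≡ true → ∀ w → not (adj K v w) ≡ true
isolated-nonadjacent K v iso w =
  and-member iso (∈-map⁺ (λ w → not (adj K v w)) (∈-allFin w))

isolated⇒uniform : ∀ {N} (G : Graph N) v → isIsolated G v ≡ true → Uniform G false v
isolated⇒uniform G v iso w _ with adj G v w | isolated-nonadjacent G v iso w
... | false | _  = refl
... | true  | ()

co-isolated⇒uniform : ∀ {N} (G : Graph N) v →
  isIsolated (complement G) v ≡ true → Uniform G true v
co-isolated⇒uniform G v iso w w≢v
  with v ≟ w | adj G v w | isolated-nonadjacent (complement G) v iso w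
... | yes v≡w | _     | _  = ⊥-elim (w≢v (sym v≡w))
... | no _    | true  | _  = refl
... | no _    | false | ()

nontrivial : ∀ {N} (M : VSet N) {a b c : Fin N} →
  M a ≡ false → M b ≡ true → M c ≡ true → b ≢ c → ¬ IsTrivialSet M
nontrivial M {b = b} _ b∈ _ _ (inj₁ empty) with trans (sym b∈) (empty b)
... | ()
nontrivial M {a = a} a∉ _ _ _ (inj₂ (inj₁ full)) with trans (sym a∉) (full a)
... | ()
nontrivial M {b = b} {c} _ b∈ c∈ b≢c (inj₂ (inj₂ (_ , singleton))) =
  b≢c (trans (proj₁ (singleton b) b∈) (sym (proj₁ (singleton c) c∈)))

nontrivial-module⇒¬prime : ∀ {N} (K : Graph N) (M : VSet N) →
  IsModule K M → ¬ IsTrivialSet M → ¬ IsPrime K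
nontrivial-module⇒¬prime K M mod nontriv (_ , prime) = nontriv (prime M mod)

third-vertex : ∀ {N} → 3 ≤ N → (u v : Fin N) → ∃ λ w → w ≢ u × w ≢ v
third-vertex {suc (suc (suc m))} (s≤s (s≤s (s≤s _))) u v with u ≟ v
... | yes refl = punchIn u F.zero , punchInᵢ≢i u F.zero , punchInᵢ≢i u F.zero
... | no u≢v   = punchIn u w , punchInᵢ≢i u w , w≢v
  where
  -- a vertex different from u and v, indexed in V ∖ {u}
  w : Fin (suc (suc m))
  w = punchIn (punchOut u≢v) F.zero
  w≢v : punchIn u w ≢ v
  w≢v e = punchInᵢ≢i (punchOut u≢v) F.zero
            (punchIn-injective u _ _ (trans e (sym (punchIn-punchOut u≢v))))

prime⇒3≤ : ∀ {N} (K : Graph N) → IsPrime K → 3 ≤ N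
prime⇒3≤ K (4≤N , _) = ≤-trans (n≤1+n 3) 4≤N

constant-adjacency : ∀ {N} (K : Graph N) (M : VSet N) (v : Fin N) (b : Bool) →
  (∀ x → M x ≡ true → adj K v x ≡ b) →
  (∀ x → M x ≡ true → adj K v x ≡ true) ⊎ (∀ x → M x ≡ true → adj K v x ≡ false)
constant-adjacency K M v true  h = inj₁ h
constant-adjacency K M v false h = inj₂ h

allBut : ∀ {N} → Fin N → VSet N
allBut u y = not ⌊ y ≟ u ⌋

allBut-∈ : ∀ {N} {u x : Fin N} → allBut u x ≡ true → x ≢ u
allBut-∈ {u = u} {x} x∈ with x ≟ u
allBut-∈ () | yes _
... | no x≢u = x≢u

allBut-∋ : ∀ {N} {u x : Fin N} → x ≢ u → allBut u x ≡ true
allBut-∋ {u = u} {x} x≢u with x ≟ u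
... | yes x≡u = ⊥-elim (x≢u x≡u)
... | no _    = refl

allBut-∌ : ∀ {N} (u : Fin N) → allBut u u ≡ false
allBut-∌ u with u ≟ u
... | yes _   = refl
... | no u≢u  = ⊥-elim (u≢u refl)

allBut-module : ∀ {N} (K : Graph N) {c u} → Uniform K c u → IsModule K (allBut u)
allBut-module K {c} {u} uniform v v∉ with v ≟ u
... | yes refl = constant-adjacency K (allBut u) u c (λ x x∈ → uniform x (allBut-∈ x∈))
allBut-module K uniform v () | no _

uniform⇒¬prime : ∀ {N} (K : Graph N) {c u} → Uniform K c u → ¬ IsPrime K
uniform⇒¬prime K {u = u} uniform prime
  with third-vertex (prime⇒3≤ K prime) u u
... | a , a≢u , _ with third-vertex (prime⇒3≤ K prime) u a
...   | b , b≢u , b≢a =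
  nontrivial-module⇒¬prime K (allBut u) (allBut-module K uniform)
    (nontrivial (allBut u) (allBut-∌ u) (allBut-∋ a≢u) (allBut-∋ b≢u) (b≢a ∘ sym)) prime

pair : ∀ {N} → Fin N → Fin N → VSet N
pair u v y = ⌊ y ≟ u ⌋ ∨ ⌊ y ≟ v ⌋

pair-∈ : ∀ {N} {u v x : Fin N} → pair u v x ≡ true → x ≡ u ⊎ x ≡ v
pair-∈ {u = u} {v} {x} x∈ with x ≟ u | x ≟ v
... | yes x≡u | _       = inj₁ x≡u
... | no _    | yes x≡v = inj₂ x≡v
pair-∈ () | no _ | no _

pair-∉ : ∀ {N} {u v x : Fin N} → pair u v x ≡ false → x ≢ u × x ≢ v
pair-∉ {u = u} {v} {x} x∉ with x ≟ u | x ≟ v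
pair-∉ () | yes _ | _
pair-∉ () | no _  | yes _
... | no x≢u | no x≢v = x≢u , x≢v

pair-∋ˡ : ∀ {N} (u v : Fin N) → pair u v u ≡ true
pair-∋ˡ u v with u ≟ u
... | yes _   = refl
... | no u≢u  = ⊥-elim (u≢u refl)

pair-∋ʳ : ∀ {N} (u v : Fin N) → pair u v v ≡ true
pair-∋ʳ u v with v ≟ u | v ≟ v
... | yes _ | _      = refl
... | no _  | yes _  = refl
... | no _  | no v≢v = ⊥-elim (v≢v refl)

pair-∌ : ∀ {N} {u v w : Fin N} → w ≢ u → w ≢ v → pair u v w ≡ false
pair-∌ {u = u} {v} {w} w≢u w≢v with w ≟ u | w ≟ v
... | yes w≡u | _       = ⊥-elim (w≢u w≡u)
... | no _    | yes w≡v = ⊥-elim (w≢v w≡v)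
... | no _    | no _    = refl

pair-module : ∀ {N} (K : Graph N) {u v} → Twins K u v → IsModule K (pair u v)
pair-module K {u} {v} twins w w∉ =
  constant-adjacency K (pair u v) w (adj K w u) (λ x x∈ → same-as-u x (pair-∈ x∈))
  where
  same-as-u : ∀ x → x ≡ u ⊎ x ≡ v → adj K w x ≡ adj K w u
  same-as-u x (inj₁ refl) = refl
  same-as-u x (inj₂ refl) = begin
    adj K w v  ≡⟨ adj-sym K w v ⟩
    adj K v w  ≡⟨ twins w (proj₁ (pair-∉ {x = w} w∉)) (proj₂ (pair-∉ {x = w} w∉)) ⟨
    adj K u w  ≡⟨ adj-sym K u w ⟩
    adj K w u  ∎
    where open ≡-Reasoning

twins⇒¬prime : ∀ {N} (K : Graph N) {u v} → u ≢ v → Twins K u v → ¬ IsPrime K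
twins⇒¬prime K {u} {v} u≢v twins prime with third-vertex (prime⇒3≤ K prime) u v
... | w , w≢u , w≢v =
  nontrivial-module⇒¬prime K (pair u v) (pair-module K twins)
    (nontrivial (pair u v) {a = w} (pair-∌ w≢u w≢v) (pair-∋ˡ u v) (pair-∋ʳ u v) u≢v) prime

module Extension {n p : ℕ} (G : Graph n) (H : Graph (n + p)) (ext : IsExtension p G H) where

  data Side : Fin (n + p) → Set where
    old : ∀ v → Side (v ↑ˡ p)
    new : ∀ x → Side (n ↑ʳ x)

  side : ∀ y → Side y
  side y with splitAt n y in split
  ... | inj₁ v = subst Side (splitAt⁻¹-↑ˡ split) (old v)
  ... | inj₂ x = subst Side (splitAt⁻¹-↑ʳ split) (new x)

  trace : Fin n → Fin p → Bool
  trace v x = adj H (v ↑ˡ p) (n ↑ʳ x)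

  uniform-lift : ∀ {c v} → Uniform G c v → (∀ x → trace v x ≡ c) → Uniform H c (v ↑ˡ p)
  uniform-lift {c} {v} uniform constant y y≢v with side y
  ... | old w = trans (ext v w) (uniform w (y≢v ∘ cong (_↑ˡ p)))
  ... | new x = constant x

  twins-lift : ∀ {c u v} → Uniform G c u → Uniform G c v →
    (∀ x → trace u x ≡ trace v x) → Twins H (u ↑ˡ p) (v ↑ˡ p)
  twins-lift {c} {u} {v} uniform-u uniform-v same y y≢u y≢v with side y
  ... | old w = begin
    adj H (u ↑ˡ p) (w ↑ˡ p)  ≡⟨ ext u w ⟩
    adj G u w                ≡⟨ uniform-u w (y≢u ∘ cong (_↑ˡ p)) ⟩
    c                        ≡⟨ uniform-v w (y≢v ∘ cong (_↑ˡ p)) ⟨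
    adj G v w                ≡⟨ ext v w ⟨
    adj H (v ↑ˡ p) (w ↑ˡ p)  ∎
    where open ≡-Reasoning
  ... | new x = same x

  -- If H is prime and the vertices satisfying P are c-uniform in G, then
  -- the constant map c and their traces are count P + 1 distinct maps
  -- Fin p → Bool, hence count P + 1 ≤ 2 ^ p.
  uniform-count-bound : (c : Bool) (P : Fin n → Bool) →
    (∀ v → P v ≡ true → Uniform G c v) → IsPrime H → suc (count P) ≤ 2 ^ p
  uniform-count-bound c P uniform prime = injective⇒≤ label-injective
    where
    vertex : Fin (count P) → Fin n
    vertex = enumerate P

    uniform-vertex : ∀ i → Uniform G c (vertex i)
    uniform-vertex i = uniform (vertex i) (enumerate-sound P i)

    constant : Fin p → Bool
    constant _ = c

    label : Fin (suc (count P)) → Fin (2 ^ p)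
    label F.zero    = encode constant
    label (F.suc i) = encode (trace (vertex i))

    trace-not-constant : ∀ i → encode constant ≢ encode (trace (vertex i))
    trace-not-constant i eq = uniform⇒¬prime H
      (uniform-lift (uniform-vertex i) (λ x → sym (encode-injective _ _ eq x))) prime

    trace-injective : ∀ i j → encode (trace (vertex i)) ≡ encode (trace (vertex j)) →
      vertex i ≡ vertex j
    trace-injective i j eq with vertex i ≟ vertex j
    ... | yes same = same
    ... | no distinct = ⊥-elim (twins⇒¬prime H (distinct ∘ ↑ˡ-injective p _ _)
            (twins-lift (uniform-vertex i) (uniform-vertex j) (encode-injective _ _ eq)) prime)

    label-injective : Injective _≡_ _≡_ label
    label-injective {F.zero}  {F.zero}  _  = refl
    label-injective {F.zero}  {F.suc j} eq = ⊥-elim (trace-not-constant j eq)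
    label-injective {F.suc i} {F.zero}  eq = ⊥-elim (trace-not-constant i (sym eq))
    label-injective {F.suc i} {F.suc j} eq =
      cong F.suc (enumerate-injective P (trace-injective i j eq))

  isolated-count-bound : (K : Graph n) (c : Bool) →
    (∀ v → isIsolated K v ≡ true → Uniform G c v) → IsPrime H → suc (ι K) ≤ 2 ^ p
  isolated-count-bound K c uniform prime =
    subst (λ k → suc k ≤ 2 ^ p) (sym (sum-indicator≡count (isIsolated K)))
      (uniform-count-bound c (isIsolated K) uniform prime)

⌈log₂⌉≤ : ∀ {m} p → m ≤ 2 ^ p → ⌈log₂ m ⌉ ≤ p
⌈log₂⌉≤ {m} p m≤2^p = subst (⌈log₂ m ⌉ ≤_) (⌈log₂2^n⌉≡n p) (⌈log₂⌉-mono-≤ m≤2^p)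

lemma5 : ∀ {n} (G : Graph n) → (ι G ≢ 0 ⊎ ι (complement G) ≢ 0) →
    ∀ (p : ℕ) (H : Graph (n + p)) → IsExtension p G H → IsPrime H →
    ⌈log₂ suc (ι G ⊔ ι (complement G)) ⌉ ≤ p
lemma5 G _ p H ext prime = ⌈log₂⌉≤ p (⊔-lub bound-G bound-Ḡ)
  where
  open Extension G H ext
  bound-G : suc (ι G) ≤ 2 ^ p
  bound-G = isolated-count-bound G false (isolated⇒uniform G) prime
  bound-Ḡ : suc (ι (complement G)) ≤ 2 ^ p
  bound-Ḡ = isolated-count-bound (complement G) true (co-isolated⇒uniform G) prime
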